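{- Neither the third-order binary Reed–Muller code $R(3,7)$ nor the code $C^{*}$ (defined in the context) has a self-dual $[128,64,d]$ neighbor with $d\in\{20,24\}$.
   Context: Two binary self-dual codes $C_1,C_2$ of length $n$ are neighbors if $\dim(C_1\cap C_2)=n/2-1$. $R(3,7)$ is the binary Reed–Muller code of length $128$ and order $3$. The code $C^{*}$ is defined as follows. Let $\Pi=PG(6,2)$, let $H$ be a hyperplane of $\Pi$ (so $H\cong PG(5,2)$), and let $\pi$ be a polarity of $H$ (an inclusion-reversing involutory bijection on subspaces of $H$; it maps projective planes of $H$ to projective planes of $H$). The polarity design $D$ has as points the $127$ points of $\Pi$ and as blocks: all projective $3$-dimensional subspaces of $\Pi$ contained in $H$, together with, for each projective $3$-dimensional subspace $S$ of $\Pi$ not contained in $H$, the set $(S\setminus H)\cup\pi(S\cap H)$. Let $C$ be the binary code of length $127$ spanned by the incidence vectors of the blocks of $D$, and $C^{*}$ the extended code obtained by appending an overall parity-check coordinate; $C^{*}$ is a self-dual $[128,64,16]$ code. -}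

module Defs where

open import Data.Bool using (Bool; true; false; _∧_; _∨_; _xor_; not; if_then_else_)
open import Data.Nat using (ℕ; zero; suc; _≤_; _<_)
open import Data.Vec using (Vec; []; _∷_; zipWith; replicate; toList)
open import Data.List using (List; []; _∷_; _++_; map; foldr)
open import Data.Product using (Σ; ∃; _×_; proj₁)
open import Function using (_∘_)
open import Function.Bundles using (_⇔_)
open import Relation.Binary.PropositionalEquality using (_≡_)

allVecs : (m : ℕ) → List (Vec Bool m)
allVecs zero = [] ∷ []
allVecs (suc m) = map (false ∷_) (allVecs m) ++ map (true ∷_) (allVecs m)

isZero : ∀ {m} → Vec Bool m → Bool
isZero [] = true
isZero (b ∷ v) = not b ∧ isZero v

_⊕ᵥ_ : ∀ {m} → Vec Bool m → Vec Bool m → Vec Bool m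
_⊕ᵥ_ = zipWith _xor_

countOn : (m : ℕ) → (Vec Bool m → Bool) → ℕ
countOn m f = foldr (λ x n → if f x then suc n else n) 0 (allVecs m)

IsLinSub : ∀ {m} → (Vec Bool m → Bool) → Set
IsLinSub {m} S = (S (replicate m false) ≡ true)
  × (∀ x y → S x ≡ true → S y ≡ true → S (x ⊕ᵥ y) ≡ true)

_⊆ₛ_ : ∀ {m} → (Vec Bool m → Bool) → (Vec Bool m → Bool) → Set
S ⊆ₛ T = ∀ x → S x ≡ true → T x ≡ true

_≗ₛ_ : ∀ {m} → (Vec Bool m → Bool) → (Vec Bool m → Bool) → Set
S ≗ₛ T = ∀ x → S x ≡ T x

-- Binary words of length 128, coordinates indexed by F_2^7

Coord : Set
Coord = Vec Bool 7

coords : List Coord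
coords = allVecs 7

Word : Set
Word = Coord → Bool

𝟎 : Word
𝟎 _ = false

_⊕_ : Word → Word → Word
(u ⊕ v) x = u x xor v x

_≗_ : Word → Word → Set
u ≗ v = ∀ x → u x ≡ v x

wt : Word → ℕ
wt = countOn 7

dot : Word → Word → Bool
dot u v = foldr (λ x b → (u x ∧ v x) xor b) false coords

sumW : List Word → Word
sumW = foldr _⊕_ 𝟎

lincomb : ∀ {k} → Vec Word k → Vec Bool k → Word
lincomb [] [] = 𝟎
lincomb (g ∷ gs) (c ∷ cs) = (λ x → c ∧ g x) ⊕ lincomb gs cs

Code : Set₁
Code = Word → Set

SpanFam : {I : Set} → (I → Word) → Code
SpanFam {I} g w = Σ (List I) (λ is → sumW (map g is) ≗ w)

Independent : ∀ {k} → Vec Word k → Set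
Independent {k} B = ∀ c → lincomb B c ≗ 𝟎 → c ≡ replicate k false

HasDim : Code → ℕ → Set
HasDim C k = Σ (Vec Word k) (λ B → Independent B
  × (∀ w → C w ⇔ ∃ (λ c → lincomb B c ≗ w)))

SelfDual : Code → Set
SelfDual C = ∀ w → C w ⇔ (∀ v → C v → dot w v ≡ false)

MinDist : Code → ℕ → Set
MinDist C d = (0 < d)
  × (∀ w → C w → 0 < wt w → d ≤ wt w)
  × ∃ (λ w → C w × wt w ≡ d)

_∩_ : Code → Code → Code
(C ∩ D) w = C w × D w

-- neighbors: self-dual codes of length n = 128 with dim(C ∩ D) = n/2 - 1
Neighbors : Code → Code → Set
Neighbors C D = SelfDual C × SelfDual D × HasDim (C ∩ D) 63

degree : Vec Bool 7 → ℕ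
degree S = foldr (λ b n → if b then suc n else n) 0 (toList S)

monomial : Vec Bool 7 → Word
monomial S x = isZero (zipWith (λ s xi → s ∧ not xi) S x)

Monomial≤3 : Set
Monomial≤3 = Σ (Vec Bool 7) (λ S → degree S ≤ 3)

RM37 : Code
RM37 = SpanFam {Monomial≤3} (monomial ∘ proj₁)

-- The polarity design code C*
-- Points of Π = PG(6,2): nonzero vectors of F_2^7; the zero vector is
-- used as the extra (overall parity-check) coordinate.
-- Hyperplane H = { x : first coordinate of x is 0 } ≅ F_2^6.
-- Subspaces of H are represented by linear subspaces of F_2^6.

PSet : Set
PSet = Vec Bool 6 → Bool

IsPolarity : (PSet → PSet) → Set
IsPolarity π =
    (∀ S T → S ≗ₛ T → π S ≗ₛ π T)
  × (∀ S → IsLinSub S → IsLinSub (π S))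
  × (∀ S T → IsLinSub S → IsLinSub T → S ⊆ₛ T → π T ⊆ₛ π S)
  × (∀ S → IsLinSub S → π (π S) ≗ₛ S)

inH : Coord → Bool
inH (b ∷ _) = not b

-- projective 3-subspaces of Π = 4-dimensional linear subspaces of F_2^7
Sub4 : Set
Sub4 = Σ (Coord → Bool) (λ S → IsLinSub S × countOn 7 S ≡ 16)

containedInH : (Coord → Bool) → Bool
containedInH S = foldr (λ x b → (not (S x) ∨ inH x) ∧ b) true coords

-- incidence vector of the block associated with S (entry at the zero
-- coordinate is irrelevant; it is overwritten by the parity check)
block : (PSet → PSet) → (Coord → Bool) → Word
block π S x with containedInH S
... | true = S x ∧ not (isZero x)
block π S (true ∷ y) | false = S (true ∷ y)
block π S (false ∷ y) | false = π (λ z → S (false ∷ z)) y ∧ not (isZero y)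

-- extension by an overall parity check, placed at the zero coordinate
ext : Word → Word
ext w x = if isZero x
  then foldr (λ y b → (not (isZero y) ∧ w y) xor b) false coords
  else w x

Cstar : (PSet → PSet) → Code
Cstar π = SpanFam (λ (S : Sub4) → ext (block π (proj₁ S)))

module Submission where

-- Let C be a self-dual code and D a self-dual neighbour of C, so
-- that K = C ∩ D has codimension one in D (dim D = 64, dim K = 63).  If
-- w₁, w₂, w₁ ⊕ w₂ are words of C none of which lies in D = D^⊥, then each of
-- them is detected by some word of D; a short case analysis produces a, b ∈ D
-- such that each of a, b, a ⊕ b is non-orthogonal to some word of C.  But K
-- has codimension one in D, so one of a, b, a ⊕ b lies in K ⊆ C = C^⊥, which
-- is absurd.  Hence one of w₁, w₂, w₁ ⊕ w₂ lies in D, and if all three have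
-- weight 16 the minimum distance of D is at most 16, excluding d ∈ {20, 24}.

open import Defs
open import Data.Bool using (Bool; true; false; _∧_; _xor_; not; _≟_)
open import Data.Bool.Properties using (xor-∧-commutativeRing; xor-assoc; xor-comm; xor-identityʳ; ∧-zeroʳ)
open import Data.Fin using (Fin; #_)
open import Data.List using (List; []; _∷_; foldr)
open import Data.Maybe using (Maybe; just; nothing)
open import Data.Nat using (ℕ; zero; suc; _<_; z≤n; s≤s)
open import Data.Nat.Properties using (≤-refl; m≤m+n; <⇒≱)
open import Data.Product using (Σ; ∃; _×_; _,_; proj₁; proj₂)
open import Data.Sum using (_⊎_; inj₁; inj₂)
open import Data.Empty using (⊥; ⊥-elim)
open import Data.Vec using (Vec; []; _∷_; replicate; zipWith; lookup)
open import Data.Vec.Properties using (≡-dec; ∷-injectiveʳ; lookup-replicate; lookup-zipWith)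
open import Data.Vec.Relation.Unary.All using (All; []; _∷_)
import Data.Vec.Relation.Unary.All as All
open import Function.Base using (_∘_)
open import Function.Bundles using (Equivalence)
open import Relation.Nullary using (¬_; yes; no)
open import Relation.Binary.PropositionalEquality using (_≡_; _≢_; refl; sym; trans; cong; cong₂; module ≡-Reasoning)
open import Tactic.RingSolver using (solve-∀)
open import Tactic.RingSolver.Core.AlmostCommutativeRing using (AlmostCommutativeRing; fromCommutativeRing)

-- F₂ = (Bool, xor, ∧) as a ring for the ring solver; coefficients are computed
-- in F₂ itself, so identities using 1 + 1 = 0 are within its reach.
𝔽₂ : AlmostCommutativeRing _ _
𝔽₂ = fromCommutativeRing xor-∧-commutativeRing is-zero
  where
  is-zero : (x : Bool) → Maybe (false ≡ x)
  is-zero false = just refl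
  is-zero true  = nothing

xor≡false⇒≡ : ∀ x y → x xor y ≡ false → x ≡ y
xor≡false⇒≡ false false _ = refl
xor≡false⇒≡ true  true  _ = refl

infixr 30 _·_
_·_ : Bool → Word → Word
(c · v) x = c ∧ v x

InSpan : ∀ {k} → Vec Word k → Word → Set
InSpan B w = ∃ λ c → lincomb B c ≗ w

InSpan-resp : ∀ {k} (B : Vec Word k) {u v} → u ≗ v → InSpan B u → InSpan B v
InSpan-resp B u≗v (c , e) = c , λ x → trans (e x) (u≗v x)

NonTrivial : ∀ {k} → Vec Bool k → Set
NonTrivial {k} c = c ≢ replicate k false

Dependent : ∀ {k} → Vec Word k → Set
Dependent {k} B = Σ (Vec Bool k) λ c → NonTrivial c × lincomb B c ≗ 𝟎

lincomb-zero : ∀ {k} (B : Vec Word k) → lincomb B (replicate k false) ≗ 𝟎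
lincomb-zero []       x = refl
lincomb-zero (g ∷ gs) x = lincomb-zero gs x

members-in-span : ∀ {k} (B : Vec Word k) → All (InSpan B) B
members-in-span []       = []
members-in-span {suc k} (g ∷ gs) =
  (true ∷ replicate k false , λ x → trans (cong (g x xor_) (lincomb-zero gs x)) (xor-identityʳ (g x)))
  ∷ All.map (λ { (c , e) → false ∷ c , e }) (members-in-span gs)

lincomb-axpy : ∀ {k} (A : Vec Word k) (e : Bool) (xs ys : Vec Bool k) →
  lincomb A (zipWith (λ xi yi → xi xor (e ∧ yi)) xs ys) ≗ (lincomb A xs ⊕ e · lincomb A ys)
lincomb-axpy []       e []       []       x = sym (∧-zeroʳ e)
lincomb-axpy (g ∷ gs) e (c ∷ xs) (d ∷ ys) x =
  trans (cong (((c xor (e ∧ d)) ∧ g x) xor_) (lincomb-axpy gs e xs ys x))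
        (distribute e c d (g x) (lincomb gs xs x) (lincomb gs ys x))
  where
  distribute : ∀ e c d g s t → ((c xor (e ∧ d)) ∧ g) xor (s xor (e ∧ t)) ≡ ((c ∧ g) xor s) xor (e ∧ ((d ∧ g) xor t))
  distribute = solve-∀ 𝔽₂

-- Exchange step: a non-trivial combination b of m+1 vectors can replace one of
-- them, i.e. every u in their span becomes, after adding a multiple of b, a
-- combination of some m vectors.
exchange : ∀ {m} (A : Vec Word (suc m)) (y : Vec Bool (suc m)) → NonTrivial y →
  Σ (Vec Word m) λ R → ∀ u → InSpan A u → Σ Bool λ e → InSpan R (u ⊕ e · lincomb A y)
exchange (a ∷ A) (true ∷ y) _ = A , pivot
  where
  pivot : ∀ u → InSpan (a ∷ A) u → Σ Bool λ e → InSpan A (u ⊕ e · lincomb (a ∷ A) (true ∷ y))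
  pivot u (e ∷ xs , p) = e , zipWith (λ xi yi → xi xor (e ∧ yi)) xs y , λ x → begin
      lincomb A (zipWith (λ xi yi → xi xor (e ∧ yi)) xs y) x
    ≡⟨ lincomb-axpy A e xs y x ⟩
      lincomb A xs x xor (e ∧ lincomb A y x)
    ≡⟨ eliminate-a e (a x) (lincomb A xs x) (lincomb A y x) ⟩
      ((e ∧ a x) xor lincomb A xs x) xor (e ∧ (a x xor lincomb A y x))
    ≡⟨ cong (_xor (e ∧ (a x xor lincomb A y x))) (p x) ⟩
      u x xor (e ∧ (a x xor lincomb A y x))
    ∎
    where
    open ≡-Reasoning
    eliminate-a : ∀ e a s t → s xor (e ∧ t) ≡ ((e ∧ a) xor s) xor (e ∧ (a xor t))
    eliminate-a = solve-∀ 𝔽₂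
exchange {zero}  (a ∷ []) (false ∷ []) nt = ⊥-elim (nt refl)
exchange {suc m} (a ∷ A)  (false ∷ y)  nt with exchange A y (λ y≡0 → nt (cong (false ∷_) y≡0))
... | R , reduce = a ∷ R , keep-a
  where
  keep-a : ∀ u → InSpan (a ∷ A) u → Σ Bool λ e → InSpan (a ∷ R) (u ⊕ e · lincomb A y)
  keep-a u (e ∷ xs , p) with reduce (lincomb A xs) (xs , λ x → refl)
  ... | e′ , c , q = e′ , e ∷ c , λ x → begin
      (e ∧ a x) xor lincomb R c x
    ≡⟨ cong ((e ∧ a x) xor_) (q x) ⟩
      (e ∧ a x) xor (lincomb A xs x xor (e′ ∧ lincomb A y x))
    ≡⟨ sym (xor-assoc (e ∧ a x) _ _) ⟩
      ((e ∧ a x) xor lincomb A xs x) xor (e′ ∧ lincomb A y x)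
    ≡⟨ cong (_xor (e′ ∧ lincomb A y x)) (p x) ⟩
      u x xor (e′ ∧ lincomb A y x)
    ∎
    where open ≡-Reasoning

shift : ∀ {k} → Word → Vec Word k → Vec Bool k → Vec Word k
shift b = zipWith (λ u e → u ⊕ e · b)

_⋅_ : ∀ {k} → Vec Bool k → Vec Bool k → Bool
[]       ⋅ []       = false
(c ∷ cs) ⋅ (e ∷ es) = (c ∧ e) xor (cs ⋅ es)

lincomb-shift : ∀ {k} b (B : Vec Word k) es c → lincomb (shift b B es) c ≗ (lincomb B c ⊕ (c ⋅ es) · b)
lincomb-shift b []       []       []       x = refl
lincomb-shift b (u ∷ B) (e ∷ es) (c ∷ cs) x =
  trans (cong ((c ∧ (u x xor (e ∧ b x))) xor_) (lincomb-shift b B es cs x))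
        (regroup c (u x) e (b x) (lincomb B cs x) (cs ⋅ es))
  where
  regroup : ∀ c u e b s t → (c ∧ (u xor (e ∧ b))) xor (s xor (t ∧ b)) ≡ ((c ∧ u) xor s) xor (((c ∧ e) xor t) ∧ b)
  regroup = solve-∀ 𝔽₂

choose-shift : ∀ {k} {P : Word → Set} b (B : Vec Word k) → All (λ u → Σ Bool λ e → P (u ⊕ e · b)) B →
  Σ (Vec Bool k) λ es → All P (shift b B es)
choose-shift b []      []              = [] , []
choose-shift b (u ∷ B) ((e , p) ∷ ps) with choose-shift b B ps
... | es , qs = e ∷ es , p ∷ qs

-- Induction on B: the head b either vanishes, or it replaces a vector of A,
-- and the shifted tail lies in the span of the remaining m - 1 vectors.
steinitz : ∀ {m k} (A : Vec Word m) (B : Vec Word k) → m < k → All (InSpan A) B → Dependent B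
steinitz {m} A (b ∷ B) m<k ((y , py) ∷ hB) with ≡-dec _≟_ y (replicate m false)
... | yes refl = true ∷ replicate _ false , (λ ()) , λ x →
  cong₂ _xor_ (trans (sym (py x)) (lincomb-zero A x)) (lincomb-zero B x)
steinitz {zero}  []      (b ∷ B) m<k (([] , py) ∷ hB) | no y≢0 = ⊥-elim (y≢0 refl)
steinitz {suc m} A       (b ∷ B) (s≤s m<k) ((y , py) ∷ hB) | no y≢0 with exchange A y y≢0
... | R , reduce with choose-shift b B (All.map (reduce-to-b _) hB)
  where
  reduce-to-b : ∀ u → InSpan A u → Σ Bool λ e → InSpan R (u ⊕ e · b)
  reduce-to-b u h with reduce u h
  ... | e , h′ = e , InSpan-resp R (λ x → cong (λ v → u x xor (e ∧ v)) (py x)) h′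
... | es , hR with steinitz R (shift b B es) m<k hR
... | c , nt , z = (c ⋅ es) ∷ c , (λ c≡0 → nt (∷-injectiveʳ c≡0)) , λ x →
  trans (xor-comm ((c ⋅ es) ∧ b x) (lincomb B c x)) (trans (sym (lincomb-shift b B es c x)) (z x))

codim-one : ∀ {n} (BD : Vec Word (suc n)) (BK : Vec Word n) → Independent BK → All (InSpan BD) BK →
  ∀ {a b} → InSpan BD a → InSpan BD b → InSpan BK a ⊎ InSpan BK b ⊎ InSpan BK (a ⊕ b)
codim-one BD BK indep hK {a} {b} ha hb with steinitz BD (a ∷ b ∷ BK) (s≤s ≤-refl) (ha ∷ hb ∷ hK)
... | false ∷ false ∷ γ , nt , z = ⊥-elim (nt (cong (λ c → false ∷ false ∷ c) (indep γ z)))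
... | true  ∷ false ∷ γ , nt , z = inj₁ (γ , λ x → sym (xor≡false⇒≡ (a x) _ (z x)))
... | false ∷ true  ∷ γ , nt , z = inj₂ (inj₁ (γ , λ x → sym (xor≡false⇒≡ (b x) _ (z x))))
... | true  ∷ true  ∷ γ , nt , z = inj₂ (inj₂ (γ , λ x →
  sym (xor≡false⇒≡ (a x xor b x) _ (trans (xor-assoc (a x) (b x) _) (z x)))))

-- The dot product over an arbitrary list of coordinates (dot = dot-on coords),
-- so that its bilinearity can be proved by induction on the list.
dot-on : List Coord → Word → Word → Bool
dot-on xs u v = foldr (λ x s → (u x ∧ v x) xor s) false xs

dot-congʳ : ∀ xs w {u v} → u ≗ v → dot-on xs w u ≡ dot-on xs w v
dot-congʳ []       w u≗v = refl
dot-congʳ (x ∷ xs) w u≗v = cong₂ (λ ux s → (w x ∧ ux) xor s) (u≗v x) (dot-congʳ xs w u≗v)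

dot-𝟎ʳ : ∀ xs w → dot-on xs w 𝟎 ≡ false
dot-𝟎ʳ []       w = refl
dot-𝟎ʳ (x ∷ xs) w = cong₂ _xor_ (∧-zeroʳ (w x)) (dot-𝟎ʳ xs w)

dot-⊕ʳ : ∀ xs w u v → dot-on xs w (u ⊕ v) ≡ dot-on xs w u xor dot-on xs w v
dot-⊕ʳ []       w u v = refl
dot-⊕ʳ (x ∷ xs) w u v =
  trans (cong ((w x ∧ (u x xor v x)) xor_) (dot-⊕ʳ xs w u v)) (regroup (w x) (u x) (v x) _ _)
  where
  regroup : ∀ w u v s t → (w ∧ (u xor v)) xor (s xor t) ≡ ((w ∧ u) xor s) xor ((w ∧ v) xor t)
  regroup = solve-∀ 𝔽₂

dot-⊕ˡ : ∀ xs u v w → dot-on xs (u ⊕ v) w ≡ dot-on xs u w xor dot-on xs v w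
dot-⊕ˡ []       u v w = refl
dot-⊕ˡ (x ∷ xs) u v w =
  trans (cong (((u x xor v x) ∧ w x) xor_) (dot-⊕ˡ xs u v w)) (regroup (u x) (v x) (w x) _ _)
  where
  regroup : ∀ u v w s t → ((u xor v) ∧ w) xor (s xor t) ≡ ((u ∧ w) xor s) xor ((v ∧ w) xor t)
  regroup = solve-∀ 𝔽₂

dot-·ʳ : ∀ xs w c v → dot-on xs w (c · v) ≡ c ∧ dot-on xs w v
dot-·ʳ []       w c v = sym (∧-zeroʳ c)
dot-·ʳ (x ∷ xs) w c v =
  trans (cong ((w x ∧ (c ∧ v x)) xor_) (dot-·ʳ xs w c v)) (regroup (w x) c (v x) _)
  where
  regroup : ∀ w c v s → (w ∧ (c ∧ v)) xor (c ∧ s) ≡ c ∧ ((w ∧ v) xor s)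
  regroup = solve-∀ 𝔽₂

orthogonal-or-detected : ∀ {k} w (B : Vec Word k) →
  (∀ c → dot w (lincomb B c) ≡ false) ⊎ (∃ λ c → dot w (lincomb B c) ≡ true)
orthogonal-or-detected w [] = inj₁ λ { [] → dot-𝟎ʳ coords w }
orthogonal-or-detected w (g ∷ gs) with orthogonal-or-detected w gs
... | inj₂ (c , detected) = inj₂ (false ∷ c , detected)
... | inj₁ orth with dot w g in wg
...   | true  = inj₂ (true ∷ replicate _ false ,
                  trans (dot-⊕ʳ coords w g (lincomb gs (replicate _ false))) (cong₂ _xor_ wg (orth (replicate _ false))))
...   | false = inj₁ λ { (c ∷ cs) → trans (dot-⊕ʳ coords w (c · g) (lincomb gs cs))
                  (cong₂ _xor_ (trans (dot-·ʳ coords w c g) (trans (cong (c ∧_) wg) (∧-zeroʳ c))) (orth cs)) }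

detected-outside : ∀ {k} (D : Code) → SelfDual D → (hD : HasDim D k) →
  ∀ w → ¬ D w → ∃ λ c → dot w (lincomb (proj₁ hD) c) ≡ true
detected-outside D sd (BD , _ , span) w w∉D with orthogonal-or-detected w BD
... | inj₂ detected = detected
... | inj₁ orth = ⊥-elim (w∉D (Equivalence.from (sd w) λ v v∈D →
  let (c , e) = Equivalence.to (span v) v∈D in trans (dot-congʳ coords w (λ x → sym (e x))) (orth c)))

DetectedBy : Code → Word → Set
DetectedBy C x = Σ Word λ w → C w × dot w x ≡ true

neighbour-triangle : ∀ {n} (C D : Code) → SelfDual C → SelfDual D →
  HasDim D (suc n) → HasDim (C ∩ D) n →
  ∀ {w₁ w₂} → C w₁ → C w₂ → C (w₁ ⊕ w₂) → ¬ D w₁ → ¬ D w₂ → ¬ D (w₁ ⊕ w₂) → ⊥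
neighbour-triangle C D sdC sdD hD@(BD , _ , spanD) (BK , indK , spanK) {w₁} {w₂} c₁ c₂ c₁₂ n₁ n₂ n₁₂ =
  separating-pair (detected-outside D sdD hD w₁ n₁)
  where
  K⊆D : All (InSpan BD) BK
  K⊆D = All.map (λ {g} h → Equivalence.to (spanD g) (proj₂ (Equivalence.from (spanK g) h))) (members-in-span BK)

  undetected-in-K : ∀ {x} → InSpan BK x → ¬ DetectedBy C x
  undetected-in-K {x} x∈K (w , w∈C , wx) with trans (sym wx) (orthogonal x (proj₁ (Equivalence.from (spanK x) x∈K)))
    where
    orthogonal : ∀ v → C v → dot w v ≡ false
    orthogonal = Equivalence.to (sdC w) w∈C
  ... | ()

  absurd-triple : ∀ a b → DetectedBy C (lincomb BD a) → DetectedBy C (lincomb BD b) →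
    DetectedBy C (lincomb BD a ⊕ lincomb BD b) → ⊥
  absurd-triple a b da db dab with codim-one BD BK indK K⊆D (a , λ x → refl) (b , λ x → refl)
  ... | inj₁ in-K        = undetected-in-K in-K da
  ... | inj₂ (inj₁ in-K) = undetected-in-K in-K db
  ... | inj₂ (inj₂ in-K) = undetected-in-K in-K dab

  dot₁₂ : ∀ v → dot (w₁ ⊕ w₂) v ≡ dot w₁ v xor dot w₂ v
  dot₁₂ = dot-⊕ˡ coords w₁ w₂

  dot-sum : ∀ w a b → dot w (lincomb BD a ⊕ lincomb BD b) ≡ dot w (lincomb BD a) xor dot w (lincomb BD b)
  dot-sum w a b = dot-⊕ʳ coords w (lincomb BD a) (lincomb BD b)

  -- From a detector a of w₁, build b so that a, b, a ⊕ b are each detected by w₁, w₂ or w₁ ⊕ w₂.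
  separating-pair : (∃ λ a → dot w₁ (lincomb BD a) ≡ true) → ⊥
  separating-pair (a , w₁a) with dot w₂ (lincomb BD a) in w₂a
  ... | true with detected-outside D sdD hD (w₁ ⊕ w₂) n₁₂
  ...   | b , w₁₂b = absurd-triple a b (w₁ , c₁ , w₁a) (w₁ ⊕ w₂ , c₁₂ , w₁₂b)
          (w₁ ⊕ w₂ , c₁₂ , trans (dot-sum (w₁ ⊕ w₂) a b)
            (cong₂ _xor_ (trans (dot₁₂ (lincomb BD a)) (cong₂ _xor_ w₁a w₂a)) w₁₂b))
  separating-pair (a , w₁a) | false with detected-outside D sdD hD w₂ n₂
  ... | b , w₂b with dot w₁ (lincomb BD b) in w₁b
  ...   | false = absurd-triple a b (w₁ , c₁ , w₁a) (w₂ , c₂ , w₂b)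
          (w₁ , c₁ , trans (dot-sum w₁ a b) (cong₂ _xor_ w₁a w₁b))
  ...   | true  = absurd-triple a b (w₁ , c₁ , w₁a) (w₂ , c₂ , w₂b)
          (w₁ ⊕ w₂ , c₁₂ , trans (dot-sum (w₁ ⊕ w₂) a b)
            (trans (cong₂ _xor_ (dot₁₂ (lincomb BD a)) (dot₁₂ (lincomb BD b)))
              (cong₂ _xor_ (cong₂ _xor_ w₁a w₂a) (cong₂ _xor_ w₁b w₂b))))

light-word-excluded : ∀ (D : Code) {d t} → MinDist D d → 0 < t → t < d → ∀ {w} → wt w ≡ t → ¬ D w
light-word-excluded D (_ , minimal , _) 0<t t<d {w} refl w∈D = <⇒≱ t<d (minimal w w∈D 0<t)

Triangle : Code → ℕ → Set
Triangle C t = Σ Word λ w₁ → Σ Word λ w₂ →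
  (C w₁ × C w₂ × C (w₁ ⊕ w₂)) × (wt w₁ ≡ t × wt w₂ ≡ t × wt (w₁ ⊕ w₂) ≡ t)

no-neighbour-above-triangle : ∀ {C t} → Triangle C t → 0 < t →
  ∀ (D : Code) d → t < d → SelfDual D → HasDim D 64 → MinDist D d → ¬ Neighbors C D
no-neighbour-above-triangle {C} {t} (w₁ , w₂ , (c₁ , c₂ , c₁₂) , (t₁ , t₂ , t₁₂)) 0<t D d t<d sdD hD md (sdC , _ , hK) =
  neighbour-triangle {63} C D sdC sdD hD hK {w₁} {w₂} c₁ c₂ c₁₂ (excluded w₁ t₁) (excluded w₂ t₂) (excluded (w₁ ⊕ w₂) t₁₂)
  where
  excluded : ∀ w → wt w ≡ t → ¬ D w
  excluded w = light-word-excluded D md 0<t t<d {w}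

generator-triangle : ∀ {I : Set} (g : I → Word) (i j : I) {t} →
  wt (g i) ≡ t → wt (g j) ≡ t → wt (g i ⊕ g j) ≡ t → Triangle (SpanFam g) t
generator-triangle g i j wi wj wij =
  g i , g j ,
  ( (i ∷ [] , λ x → xor-identityʳ (g i x))
  , (j ∷ [] , λ x → xor-identityʳ (g j x))
  , (i ∷ j ∷ [] , λ x → cong (g i x xor_) (xor-identityʳ (g j x))) ) ,
  (wi , wj , wij)

x₁x₂x₃ x₁x₂x₄ : Monomial≤3
x₁x₂x₃ = (true ∷ true ∷ true ∷ false ∷ false ∷ false ∷ false ∷ []) , s≤s (s≤s (s≤s z≤n))
x₁x₂x₄ = (true ∷ true ∷ false ∷ true ∷ false ∷ false ∷ false ∷ []) , s≤s (s≤s (s≤s z≤n))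

RM37-triangle : Triangle RM37 16
RM37-triangle = generator-triangle (monomial ∘ proj₁) x₁x₂x₃ x₁x₂x₄ refl refl refl

zeros-of : Fin 7 → Fin 7 → Fin 7 → Coord → Bool
zeros-of i j k x = not (lookup x i) ∧ (not (lookup x j) ∧ not (lookup x k))

zeros-of-linear : ∀ i j k → IsLinSub (zeros-of i j k)
zeros-of-linear i j k = contains-zero , closed
  where
  contains-zero : zeros-of i j k (replicate 7 false) ≡ true
  contains-zero rewrite lookup-replicate i false | lookup-replicate j false | lookup-replicate k false = refl

  sum-of-zeros : ∀ a b c a′ b′ c′ → not a ∧ (not b ∧ not c) ≡ true → not a′ ∧ (not b′ ∧ not c′) ≡ true →
    not (a xor a′) ∧ (not (b xor b′) ∧ not (c xor c′)) ≡ true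
  sum-of-zeros false false false false false false _ _ = refl
  sum-of-zeros true  _     _     _     _     _     () _
  sum-of-zeros false true  _     _     _     _     () _
  sum-of-zeros false false true  _     _     _     () _
  sum-of-zeros false false false true  _     _     _ ()
  sum-of-zeros false false false false true  _     _ ()
  sum-of-zeros false false false false false true  _ ()

  closed : ∀ x y → zeros-of i j k x ≡ true → zeros-of i j k y ≡ true → zeros-of i j k (x ⊕ᵥ y) ≡ true
  closed x y zx zy
    rewrite lookup-zipWith _xor_ i x y | lookup-zipWith _xor_ j x y | lookup-zipWith _xor_ k x y =
    sum-of-zeros (lookup x i) (lookup x j) (lookup x k) (lookup y i) (lookup y j) (lookup y k) zx zy

-- In C*: the 3-spaces x₀ = x₁ = x₂ = 0 and x₀ = x₁ = x₃ = 0 of the hyperplane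
-- H = {x₀ = 0} meet in a plane, so their blocks and the sum of these have weight 16.
H₀₁₂ H₀₁₃ : Sub4
H₀₁₂ = zeros-of (# 0) (# 1) (# 2) , zeros-of-linear (# 0) (# 1) (# 2) , refl
H₀₁₃ = zeros-of (# 0) (# 1) (# 3) , zeros-of-linear (# 0) (# 1) (# 3) , refl

Cstar-triangle : ∀ π → Triangle (Cstar π) 16
Cstar-triangle π = generator-triangle (λ S → ext (block π (proj₁ S))) H₀₁₂ H₀₁₃ refl refl refl

16<20or24 : ∀ {d} → d ≡ 20 ⊎ d ≡ 24 → 16 < d
16<20or24 (inj₁ refl) = m≤m+n 17 3
16<20or24 (inj₂ refl) = m≤m+n 17 7

-- Both codes contain a weight-16 triangle (for C* independently of the
-- polarity, since both blocks lie in H), and 16 < d for d ∈ {20, 24}.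
proposition2 :
    (∀ (D : Code) (d : ℕ) → (d ≡ 20 ⊎ d ≡ 24)
      → SelfDual D → HasDim D 64 → MinDist D d → ¬ Neighbors RM37 D)
    × (∀ (π : PSet → PSet) → IsPolarity π
      → ∀ (D : Code) (d : ℕ) → (d ≡ 20 ⊎ d ≡ 24)
      → SelfDual D → HasDim D 64 → MinDist D d → ¬ Neighbors (Cstar π) D)
proposition2 =
    (λ D d d∈ → no-neighbour-above-triangle RM37-triangle 0<16 D d (16<20or24 d∈))
  , (λ π _ D d d∈ → no-neighbour-above-triangle (Cstar-triangle π) 0<16 D d (16<20or24 d∈))
  where
  0<16 : 0 < 16
  0<16 = s≤s z≤n
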